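{- Let $n\ge2$ and $\lambda=(\lambda_1,\dots,\lambda_d)$ a partition of $n$ such that $\gcd(\lambda_t,n-1)=1$ for every $t$. Then the poset $P(\lambda)\smallsetminus\{0\}$ is self-dual; indeed, under the identification of its elements with $\{1,\dots,n-2\}$, the map $x\mapsto n-1-x$ is an order-reversing poset isomorphism of $P(\lambda)\smallsetminus\{0\}$ onto itself.
   Context: $\Delta_\lambda=\mathrm{conv}(e_1,\dots,e_d,\lambda)\subset\mathbb{R}^d$ ($e_i$ standard basis vectors), with fundamental parallelepiped $\Pi_\lambda=\{\sum_{i=1}^d\gamma_i(1,e_i)+\gamma_{d+1}(1,\lambda): 0\le\gamma_i<1\}$. The poset $P(\lambda)$ is $\Pi_\lambda\cap\mathbb{Z}^{d+1}$ with $\sigma\preceq\mu$ iff $\mu-\sigma\in\Pi_\lambda\cap\mathbb{Z}^{d+1}$; its elements are identified with $b\in\{0,\dots,n-2\}$ via the bijection $b\mapsto p(b)=\big((\sum_{t}\lceil b\lambda_t/(n-1)\rceil)-b,\lceil b\lambda_1/(n-1)\rceil,\dots,\lceil b\lambda_d/(n-1)\rceil\big)$, with $b=0$ the origin. A poset is self-dual if it is isomorphic to its order dual. -}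

module Defs where

open import Data.Nat as ℕ using (ℕ; zero; suc; _∸_; _≤_)
open import Data.Nat.DivMod using (_/_)
open import Data.Nat.GCD using (gcd)
open import Data.Fin using (Fin; zero; suc)
open import Data.Integer as ℤ using (ℤ; +_)
open import Data.Rational as ℚ using (ℚ; 0ℚ; 1ℚ)
open import Data.Product using (Σ; _×_)
open import Relation.Binary.PropositionalEquality using (_≡_)

sumℕ : ∀ {d} → (Fin d → ℕ) → ℕ
sumℕ {zero} f = 0
sumℕ {suc d} f = f zero ℕ.+ sumℕ (λ i → f (suc i))

sumℚ : ∀ {d} → (Fin d → ℚ) → ℚ
sumℚ {zero} f = 0ℚ
sumℚ {suc d} f = f zero ℚ.+ sumℚ (λ i → f (suc i))

toℚ : ℤ → ℚ
toℚ z = z ℚ./ 1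

IsPartition : ℕ → (d : ℕ) → (Fin d → ℕ) → Set
IsPartition n d lam =
  (∀ t → 1 ≤ lam t) × (∀ s t → Data.Fin._≤_ s t → lam t ≤ lam s) × (sumℕ lam ≡ n)

-- ceiling division: ceilDiv a m = ⌈ a / m ⌉ for m ≥ 1 (value 0 for m = 0, never used)
ceilDiv : ℕ → ℕ → ℕ
ceilDiv a zero = 0
ceilDiv a (suc m) = (a ℕ.+ m) / suc m

-- points of Z^{d+1}; coordinate 'zero' is the first (height) coordinate,
-- coordinate 'suc t' is the coordinate of e_{t+1}
Pt : ℕ → Set
Pt d = Fin (suc d) → ℤ

-- the bijection b ↦ p(b) from {0,…,n-2} to Π_λ ∩ Z^{d+1}
p : (n d : ℕ) → (Fin d → ℕ) → ℕ → Pt d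
p n d lam b zero    = + sumℕ (λ t → ceilDiv (b ℕ.* lam t) (n ∸ 1)) ℤ.- + b
p n d lam b (suc t) = + ceilDiv (b ℕ.* lam t) (n ∸ 1)

-- v lies in the half-open fundamental parallelepiped
--   Π_λ = { Σ_i γ_i (1,e_i) + γ_{d+1} (1,λ) : 0 ≤ γ_i < 1 }
InΠ : (d : ℕ) → (Fin d → ℕ) → Pt d → Set
InΠ d lam v =
  Σ (Fin d → ℚ) λ γ → Σ ℚ λ γ' →
    (∀ i → (0ℚ ℚ.≤ γ i) × (γ i ℚ.< 1ℚ)) ×
    (0ℚ ℚ.≤ γ') × (γ' ℚ.< 1ℚ) ×
    (toℚ (v zero) ≡ sumℚ γ ℚ.+ γ') ×
    (∀ t → toℚ (v (suc t)) ≡ γ t ℚ.+ γ' ℚ.* toℚ (+ lam t))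

_⪯[_]_ : ∀ {d} → Pt d → (Fin d → ℕ) → Pt d → Set
_⪯[_]_ {d} σ lam μ = InΠ d lam (λ i → μ i ℤ.- σ i)

Leq : (n d : ℕ) → (Fin d → ℕ) → ℕ → ℕ → Set
Leq n d lam x y = p n d lam x ⪯[ lam ] p n d lam y

-- With m = n − 1, the coprimality hypothesis says that m never divides b λ_t for 0 < b < m.
-- Two non-multiples of m that add up to λ_t m have ceilings adding up to λ_t + 1, so
-- p(m − b) + p(b) is a vector independent of b. Hence p(y) − p(x) = p(m − x) − p(m − y),
-- and since the order only depends on differences, x ⪯ y iff m − y ⪯ m − x. Of the partition
-- hypothesis nothing is needed beyond coprimality of the parts with m.
module Submission where

open import Defs
open import Data.Nat using (ℕ; _∸_; _≤_)
open import Data.Nat.GCD using (gcd)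
open import Data.Fin using (Fin)
open import Data.Product using (_×_)
open import Function.Bundles using (_⇔_)
open import Relation.Binary.PropositionalEquality using (_≡_)

open import Data.Nat using (zero; suc; _+_; _*_; _<_; s≤s)
open import Data.Nat.Properties
  using (+-suc; +-cancelˡ-≡; *-comm; *-distribʳ-+; m≤m+n; m≤n+m; m<n⇒m<1+n; m∸n+n≡m;
         ≤-trans; ≤-reflexive; <⇒≱; <⇒≤; *-cancelʳ-<; m≤n⇒∃[o]m+o≡n; m<n⇒0<n∸m; ∸-monoʳ-≤; ∸-monoʳ-<)
open import Data.Nat.DivMod using (_/_; _%_; m≡m%n+[m/n]*n; m%n<n; m<n⇒m/n≡0; m*n/n≡m; +-distrib-/-∣ʳ)
open import Data.Nat.Divisibility using (_∣_; n∣m*n; m%n≡0⇒n∣m; ∣⇒≤)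
open import Data.Nat.Coprimality using (Coprime; coprime-divisor; gcd≡1⇒coprime)
import Data.Nat.Coprimality as Coprime
import Data.Nat.Tactic.RingSolver as ℕ-Solver
open import Data.Integer as ℤ using (ℤ; +_)
open import Data.Integer.Properties using (pos-+)
import Data.Integer.Tactic.RingSolver as ℤ-Solver
open import Data.Fin using (zero; suc)
open import Data.Product using (_,_)
open import Function.Bundles using (mk⇔)
open import Relation.Binary.PropositionalEquality
  using (refl; sym; trans; cong; cong₂; subst; module ≡-Reasoning)
open import Relation.Nullary using (¬_; contradiction)

sumℕ-cong : ∀ {d} {f g : Fin d → ℕ} → (∀ t → f t ≡ g t) → sumℕ f ≡ sumℕ g
sumℕ-cong {zero}  f≡g = refl
sumℕ-cong {suc d} f≡g = cong₂ _+_ (f≡g zero) (sumℕ-cong (λ t → f≡g (suc t)))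

sumℕ-+ : ∀ {d} (f g : Fin d → ℕ) → sumℕ (λ t → f t + g t) ≡ sumℕ f + sumℕ g
sumℕ-+ {zero}  f g = refl
sumℕ-+ {suc d} f g = trans (cong (_+_ (f zero + g zero)) (sumℕ-+ (λ t → f (suc t)) (λ t → g (suc t))))
                           (interchange (f zero) (g zero) _ _)
  where
  interchange : ∀ a b c e → a + b + (c + e) ≡ a + c + (b + e)
  interchange = ℕ-Solver.solve-∀

ceilDiv-suc-+-* : ∀ q r k → r < suc k → ceilDiv (suc r + q * suc k) (suc k) ≡ suc q
ceilDiv-suc-+-* q r k r<m = begin
  (suc r + q * suc k + k) / suc k         ≡⟨ cong (_/ suc k) (regroup r q k) ⟩
  (r + suc q * suc k) / suc k             ≡⟨ +-distrib-/-∣ʳ r (n∣m*n (suc q)) ⟩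
  r / suc k + suc q * suc k / suc k       ≡⟨ cong₂ _+_ (m<n⇒m/n≡0 r<m) (m*n/n≡m (suc q) (suc k)) ⟩
  suc q                                   ∎
  where
  open ≡-Reasoning
  regroup : ∀ r q k → suc r + q * suc k + k ≡ r + suc q * suc k
  regroup = ℕ-Solver.solve-∀

-- Writing a = (1 + r) + q m, the complement is c = (1 + s) + l' m with r + 1 + s = m − 1 and
-- q + 1 + l' = l; both ceilings then round up by exactly one.
ceilDiv-+-ceilDiv : ∀ a c l k → a + c ≡ l * suc k → ¬ suc k ∣ a →
                    ceilDiv a (suc k) + ceilDiv c (suc k) ≡ suc l
ceilDiv-+-ceilDiv a c l k a+c≡lm m∤a
  with a % suc k | a / suc k | m≡m%n+[m/n]*n a (suc k) | m%n<n a (suc k) | m%n≡0⇒n∣m a (suc k)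
... | zero  | _ | _    | _             | m∣a = contradiction (m∣a refl) m∤a
... | suc r | q | refl | s≤s (s≤s r<k) | _
  with m≤n⇒∃[o]m+o≡n r<k | m≤n⇒∃[o]m+o≡n q<l
  where
  q<l : q < l
  q<l = *-cancelʳ-< (suc k) q l
          (≤-trans (s≤s (≤-trans (m≤n+m (q * suc k) r) (m≤m+n (r + q * suc k) c))) (≤-reflexive a+c≡lm))
... | s , refl | l′ , refl = begin
  ceilDiv (suc r + q * m) m + ceilDiv c m                ≡⟨ cong (λ z → ceilDiv (suc r + q * m) m + ceilDiv z m) c≡ ⟩
  ceilDiv (suc r + q * m) m + ceilDiv (suc s + l′ * m) m ≡⟨ cong₂ _+_ (ceilDiv-suc-+-* q r k r<m) (ceilDiv-suc-+-* l′ s k s<m) ⟩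
  suc q + suc l′                                         ≡⟨ +-suc (suc q) l′ ⟩
  suc (suc q + l′)                                       ∎
  where
  open ≡-Reasoning
  m = suc k
  r<m : r < m
  r<m = m<n⇒m<1+n (m≤m+n (suc r) s)
  s<m : s < m
  s<m = s≤s (m≤n+m s (suc r))
  split : ∀ r s q l′ → let m = suc (suc r + s) in (suc q + l′) * m ≡ suc r + q * m + (suc s + l′ * m)
  split = ℕ-Solver.solve-∀
  c≡ : c ≡ suc s + l′ * m
  c≡ = +-cancelˡ-≡ (suc r + q * m) c (suc s + l′ * m) (trans a+c≡lm (split r s q l′))

coprime⇒∤* : ∀ {m l b} → Coprime m l → 0 < b → b < m → ¬ m ∣ b * l
coprime⇒∤* {m} {l} {b@(suc _)} cop _ b<m m∣bl =
  <⇒≱ b<m (∣⇒≤ (coprime-divisor cop (subst (m ∣_) (*-comm b l) m∣bl)))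

ceilDiv-mirror : ∀ k l b → Coprime (suc k) l → 0 < b → b < suc k →
                 ceilDiv ((suc k ∸ b) * l) (suc k) + ceilDiv (b * l) (suc k) ≡ suc l
ceilDiv-mirror k l b cop 0<b b<m =
  ceilDiv-+-ceilDiv ((m ∸ b) * l) (b * l) l k sum≡
    (coprime⇒∤* cop (m<n⇒0<n∸m b<m) (∸-monoʳ-< 0<b (<⇒≤ b<m)))
  where
  m = suc k
  sum≡ : (m ∸ b) * l + b * l ≡ l * m
  sum≡ = trans (sym (*-distribʳ-+ l (m ∸ b) b)) (trans (cong (_* l) (m∸n+n≡m (<⇒≤ b<m))) (*-comm m l))

mirrorSum : (k d : ℕ) → (Fin d → ℕ) → Pt d
mirrorSum k d lam zero    = + sumℕ (λ t → suc (lam t)) ℤ.- + suc k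
mirrorSum k d lam (suc t) = + suc (lam t)

p-mirror : ∀ k d lam → (∀ t → Coprime (suc k) (lam t)) → ∀ b → 0 < b → b < suc k →
           ∀ i → p (2 + k) d lam (suc k ∸ b) i ℤ.+ p (2 + k) d lam b i ≡ mirrorSum k d lam i
p-mirror k d lam cop b 0<b b<m (suc t) =
  trans (sym (pos-+ (ceilDiv ((suc k ∸ b) * lam t) (suc k)) (ceilDiv (b * lam t) (suc k))))
        (cong +_ (ceilDiv-mirror k (lam t) b (cop t) 0<b b<m))
p-mirror k d lam cop b 0<b b<m zero = begin
  (+ S (m ∸ b) ℤ.- + (m ∸ b)) ℤ.+ (+ S b ℤ.- + b)   ≡⟨ regroup (+ S (m ∸ b)) (+ (m ∸ b)) (+ S b) (+ b) ⟩
  (+ S (m ∸ b) ℤ.+ + S b) ℤ.- (+ (m ∸ b) ℤ.+ + b) ≡⟨ cong₂ ℤ._-_ (sym (pos-+ (S (m ∸ b)) (S b))) (sym (pos-+ (m ∸ b) b)) ⟩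
  + (S (m ∸ b) + S b) ℤ.- + (m ∸ b + b)           ≡⟨ cong₂ (λ u v → + u ℤ.- + v) sums (m∸n+n≡m (<⇒≤ b<m)) ⟩
  + sumℕ (λ t → suc (lam t)) ℤ.- + m              ∎
  where
  open ≡-Reasoning
  m = suc k
  C : ℕ → Fin d → ℕ
  C b t = ceilDiv (b * lam t) m
  S : ℕ → ℕ
  S b = sumℕ (C b)
  regroup : ∀ a b c e → (a ℤ.- b) ℤ.+ (c ℤ.- e) ≡ (a ℤ.+ c) ℤ.- (b ℤ.+ e)
  regroup = ℤ-Solver.solve-∀
  sums : S (m ∸ b) + S b ≡ sumℕ (λ t → suc (lam t))
  sums = trans (sym (sumℕ-+ (C (m ∸ b)) (C b))) (sumℕ-cong (λ t → ceilDiv-mirror k (lam t) b (cop t) 0<b b<m))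

+≡+⇒-≡- : ∀ (u x v y : ℤ) → u ℤ.+ x ≡ v ℤ.+ y → y ℤ.- x ≡ u ℤ.- v
+≡+⇒-≡- u x v y eq = begin
  y ℤ.- x               ≡⟨ cancel-v v y x ⟩
  (v ℤ.+ y) ℤ.- v ℤ.- x ≡⟨ cong (λ w → w ℤ.- v ℤ.- x) (sym eq) ⟩
  (u ℤ.+ x) ℤ.- v ℤ.- x ≡⟨ cancel-x u x v ⟩
  u ℤ.- v               ∎
  where
  open ≡-Reasoning
  cancel-v : ∀ v y x → y ℤ.- x ≡ (v ℤ.+ y) ℤ.- v ℤ.- x
  cancel-v = ℤ-Solver.solve-∀
  cancel-x : ∀ u x v → (u ℤ.+ x) ℤ.- v ℤ.- x ≡ u ℤ.- v
  cancel-x = ℤ-Solver.solve-∀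

InΠ-cong : ∀ {d lam} {v w : Pt d} → (∀ i → v i ≡ w i) → InΠ d lam v → InΠ d lam w
InΠ-cong v≡w (γ , γ′ , γ-bounds , 0≤γ′ , γ′<1 , height , coords) =
  γ , γ′ , γ-bounds , 0≤γ′ , γ′<1 ,
  trans (cong toℚ (sym (v≡w zero))) height , λ t → trans (cong toℚ (sym (v≡w (suc t)))) (coords t)

Leq-mirror : ∀ k d lam → (∀ t → Coprime (suc k) (lam t)) →
             ∀ x y → 0 < x → x < suc k → 0 < y → y < suc k →
             Leq (2 + k) d lam x y ⇔ Leq (2 + k) d lam (suc k ∸ y) (suc k ∸ x)
Leq-mirror k d lam cop x y 0<x x<m 0<y y<m =
  mk⇔ (InΠ-cong {lam = lam} diff≡) (InΠ-cong {lam = lam} (λ i → sym (diff≡ i)))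
  where
  P : ℕ → Pt d
  P = p (2 + k) d lam
  diff≡ : ∀ i → P y i ℤ.- P x i ≡ P (suc k ∸ x) i ℤ.- P (suc k ∸ y) i
  diff≡ i = +≡+⇒-≡- (P (suc k ∸ x) i) (P x i) (P (suc k ∸ y) i) (P y i)
    (trans (p-mirror k d lam cop x 0<x x<m i) (sym (p-mirror k d lam cop y 0<y y<m i)))

theorem2p20 : (n d : ℕ) (lam : Fin d → ℕ) → 2 ≤ n → IsPartition n d lam →
    (∀ t → gcd (lam t) (n ∸ 1) ≡ 1) →
    ∀ x y → 1 ≤ x → x ≤ n ∸ 2 → 1 ≤ y → y ≤ n ∸ 2 →
    ((1 ≤ n ∸ 1 ∸ x) × (n ∸ 1 ∸ x ≤ n ∸ 2)) ×
    (Leq n d lam x y ⇔ Leq n d lam (n ∸ 1 ∸ y) (n ∸ 1 ∸ x))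
theorem2p20 (suc zero)    d lam (s≤s ()) _ _ _ _ _ _ _ _
theorem2p20 (suc (suc k)) d lam _ _ gcd≡1 x y 1≤x x≤k 1≤y y≤k =
  (m<n⇒0<n∸m (s≤s x≤k) , ∸-monoʳ-≤ (suc k) 1≤x) ,
  Leq-mirror k d lam (λ t → Coprime.sym (gcd≡1⇒coprime (gcd≡1 t))) x y 1≤x (s≤s x≤k) 1≤y (s≤s y≤k)
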